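{- Let $X$ be a finite connected directed graph and let $\alpha$ be a constant $\mathbb{Z}_p$-valued voltage assignment on $X$ whose value lies in $\mathbb{Z}_p^\times$. Then the derived graph $X(\mathbb{Z}/p^n\mathbb{Z},\alpha_{/n})$ is connected for all $n\ge0$ if and only if $\tilde X$ contains a (directed) cycle whose weight is coprime to $p$.
   Context: Directed graphs may have multiple edges and loops; a directed graph is connected if its underlying undirected graph is connected. For an abelian group $G$ and $\alpha:\mathbb{E}(X)\to G$, the derived graph $X(G,\alpha)$ has vertex set $\mathbb{V}(X)\times G$ and edge set $\mathbb{E}(X)\times G$, where if $e$ goes from $s$ to $t$ then $(e,\sigma)$ goes from $(s,\sigma)$ to $(t,\sigma+\alpha(e))$. For $\alpha:\mathbb{E}(X)\to\mathbb{Z}_p$, $\alpha_{/n}$ is its composite with $\mathbb{Z}_p\to\mathbb{Z}/p^n\mathbb{Z}$; $\alpha$ is constant if it takes the same value on all edges. $\tilde X$ is the directed graph with the same vertices as $X$ and edge set $\mathbb{E}(X)\sqcup\mathbb{E}(X)^\iota$, where $\mathbb{E}(X)^\iota$ consists of a reversed copy of each edge of $X$. Put $w(e)=1$ for $e\in\mathbb{E}(X)$ and $w(e)=-1$ for $e\in\mathbb{E}(X)^\iota$; the weight of a directed path in $\tilde X$ with edges $e_1,\dots,e_r$ is $\sum_i w(e_i)$. -}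

module Defs where

open import Data.Nat using (ℕ; zero; suc; _+_; _*_; _^_; _%_; NonZero; _≡ᵇ_)
open import Data.Nat.Base using (nonTrivial⇒nonZero)
open import Data.Nat.Properties using (m^n≢0)
open import Data.Nat.DivMod using (m%n<n)
open import Data.Nat.Primality using (Prime; prime)
open import Data.Fin using (Fin; toℕ; fromℕ<)
open import Data.Product using (_×_; _,_; proj₁; proj₂)
open import Data.Sum using (_⊎_; inj₁; inj₂)
open import Data.List using (List; []; _∷_)
open import Data.Integer as ℤ using (ℤ)
open import Relation.Nullary using (¬_)
open import Relation.Binary.PropositionalEquality using (_≡_)

record DiGraph : Set₁ where
  field
    Vert : Set
    Edge : Set
    src  : Edge → Vert
    tgt  : Edge → Vert

open DiGraph public

record FinGraph : Set where
  field
    nV  : ℕ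
    nE  : ℕ
    fsrc : Fin nE → Fin nV
    ftgt : Fin nE → Fin nV

open FinGraph public

toDiGraph : FinGraph → DiGraph
toDiGraph X = record { Vert = Fin (nV X) ; Edge = Fin (nE X) ; src = fsrc X ; tgt = ftgt X }

-- Connectivity of the underlying undirected graph: steps may follow an
-- edge forwards or backwards.
data Joined (G : DiGraph) : Vert G → Vert G → Set where
  here : ∀ {v} → Joined G v v
  fwd  : ∀ {w} (e : Edge G) → Joined G (tgt G e) w → Joined G (src G e) w
  bwd  : ∀ {w} (e : Edge G) → Joined G (src G e) w → Joined G (tgt G e) w

Connected : DiGraph → Set
Connected G = Vert G × (∀ u v → Joined G u v)

-- p-adic integers Z_p, represented by their base-p digit expansions
-- a = Σ_i a(i) p^i.
ℤp : ℕ → Set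
ℤp p = ℕ → Fin p

-- the representative in [0, p^n) of the image of a under Z_p → Z/p^n Z
digitSum : (p : ℕ) → ℤp p → ℕ → ℕ
digitSum p a zero    = 0
digitSum p a (suc n) = digitSum p a n + toℕ (a n) * p ^ n

reduce : (p : ℕ) → ℤp p → ℕ → ℕ
reduce p a n = digitSum p a n

IsUnit : (p : ℕ) → ℤp p → Set
IsUnit p a = ¬ (toℕ (a 0) ≡ 0)

-- derived graph X(Z/mZ, β) where β(e) ∈ Z/mZ is given by a natural
-- representative; Z/mZ is realised as Fin m with addition mod m.
addMod : (m : ℕ) .{{_ : NonZero m}} → Fin m → ℕ → Fin m
addMod m σ b = fromℕ< (m%n<n (toℕ σ + b) m)

derived : (X : FinGraph) (m : ℕ) .{{_ : NonZero m}} → (Fin (nE X) → ℕ) → DiGraph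
derived X m β = record
  { Vert = Fin (nV X) × Fin m
  ; Edge = Fin (nE X) × Fin m
  ; src  = λ { (e , σ) → (fsrc X e , σ) }
  ; tgt  = λ { (e , σ) → (ftgt X e , addMod m σ (β e)) }
  }

derivedPn : (X : FinGraph) (p : ℕ) → Prime p → (Fin (nE X) → ℤp p) → ℕ → DiGraph
derivedPn X p (prime _) α n =
  derived X (p ^ n) {{m^n≢0 p n {{nonTrivial⇒nonZero p}}}} (λ e → reduce p (α e) n)

-- The graph X̃: edges E(X) ⊔ E(X)^ι (inj₂ e is the reversed copy of e).
Dart : FinGraph → Set
Dart X = Fin (nE X) ⊎ Fin (nE X)

dsrc : (X : FinGraph) → Dart X → Fin (nV X)
dsrc X (inj₁ e) = fsrc X e
dsrc X (inj₂ e) = ftgt X e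

dtgt : (X : FinGraph) → Dart X → Fin (nV X)
dtgt X (inj₁ e) = ftgt X e
dtgt X (inj₂ e) = fsrc X e

w : (X : FinGraph) → Dart X → ℤ
w X (inj₁ _) = ℤ.+ 1
w X (inj₂ _) = ℤ.- (ℤ.+ 1)

data Path (X : FinGraph) : Fin (nV X) → Fin (nV X) → Set where
  []  : ∀ {v} → Path X v v
  _∷_ : ∀ {w'} (d : Dart X) → Path X (dtgt X d) w' → Path X (dsrc X d) w'

weight : ∀ {X u v} → Path X u v → ℤ
weight [] = ℤ.+ 0
weight {X} (d ∷ π) = w X d ℤ.+ weight π

starts : ∀ {X u v} → Path X u v → List (Fin (nV X))
starts [] = []
starts {X} (d ∷ π) = dsrc X d ∷ starts π

pathLength : ∀ {X u v} → Path X u v → ℕ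
pathLength [] = 0
pathLength (_ ∷ π) = suc (pathLength π)

module Submission where

open import Defs
open import Data.Nat using (ℕ; _<_)
open import Data.Nat.Primality using (Prime)
open import Data.Nat.Coprimality using (Coprime)
open import Data.Integer using (∣_∣)
open import Data.Fin using (Fin)
open import Data.Product using (Σ; _×_)
open import Data.List.Relation.Unary.Unique.Propositional using (Unique)
open import Relation.Binary.PropositionalEquality using (_≡_)
open import Function.Bundles using (_⇔_)

open import Data.Nat as ℕ using (zero; suc; z≤n; s≤s; NonZero; _^_; _%_)
import Data.Nat.Properties as ℕP
import Data.Nat.DivMod as ℕDM
open import Data.Nat.Divisibility using (_∣_; ∣-refl; ∣-trans; ∣1⇒≡1; n∣m⇒m%n≡0; m∣m*n)
open import Data.Nat.Primality using (prime; prime⇒irreducible; prime⇒nonZero; euclidsLemma; ¬prime[1])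
import Data.Nat.Coprimality as Coprimality
open import Data.Nat.GCD using (module Bézout)
import Data.Nat.Tactic.RingSolver as ℕSolver
open import Data.Integer as ℤ using (ℤ; +_; -_; _-_; _+_; _*_; 0ℤ; 1ℤ)
import Data.Integer.Properties as ℤP
open import Data.Integer.DivMod using (_%ℕ_; _/ℕ_; n%ℕd<d; a≡a%ℕn+[a/ℕn]*n)
open import Data.Integer.Divisibility.Signed as ℤD using (∣ᵤ⇒∣; ∣⇒∣ᵤ; ∣m∣n⇒∣m+n; ∣m⇒∣-m; ∣n⇒∣m*n)
  renaming (_∣_ to _∣ℤ_)
open import Data.Integer.Tactic.RingSolver using (solve-∀)
open import Data.Fin as Fin using (toℕ; fromℕ<)
open import Data.Fin.Properties using (toℕ-fromℕ<; toℕ-injective; toℕ<n)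
open import Data.Product using (_,_; proj₁; proj₂)
open import Data.Sum using (_⊎_; inj₁; inj₂; [_,_]′)
open import Data.Empty using (⊥-elim)
open import Data.List using ([]; _∷_; _++_)
open import Data.List.Membership.Propositional using (_∈_; _∉_)
open import Data.List.Relation.Unary.Any using (here; there)
open import Data.List.Relation.Unary.All.Properties using (¬Any⇒All¬; ++⁻ˡ)
open import Data.List.Relation.Unary.AllPairs using (AllPairs; []; _∷_)
open import Relation.Binary.Core using (Rel)
open import Relation.Binary.Bundles using (Setoid)
open import Relation.Binary.Structures using (IsEquivalence)
import Relation.Binary.Reasoning.Setoid as SetoidReasoning
open import Relation.Binary.PropositionalEquality
  using (refl; sym; trans; cong; cong₂; subst; subst₂; module ≡-Reasoning)
open import Relation.Nullary using (¬_; Dec; yes; no; map′)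
open import Function.Bundles using (mk⇔)

-- With the constant voltage A = α_{/n}, the vertices of X(ℤ/p^nℤ, α_{/n}) over u are the levels
-- (u, σ), and a walk π in X̃ from u to u′ lifts to a walk from (u, σ) to (u′, σ + A·w(π));
-- conversely every walk in the derived graph is such a lift.  If the derived graph mod p is
-- connected, joining (v, 0) to (v, 1) gives a closed walk with A·w ≡ 1 (mod p); cutting it at
-- repeated vertices into simple cycles, one of them has weight prime to p.  Conversely, if a
-- simple cycle c has p ∤ w(c), then A·w(c) is invertible mod p^n because A is a p-adic unit,
-- so going round c a suitable number of times reaches every level over its base point, and
-- connectivity of X does the rest.

-- Congruences of integers

infix 4 _≡_mod_ _≡?_mod_

record _≡_mod_ (x y : ℤ) (m : ℕ) : Set where
  constructor modulo
  field
    divides-difference : + m ∣ℤ (x - y)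

open _≡_mod_ public

module _ {m : ℕ} where

  ≡⇒≡-mod : ∀ {x y} → x ≡ y → x ≡ y mod m
  ≡⇒≡-mod {x} refl = modulo (subst (+ m ∣ℤ_) (sym (ℤP.+-inverseʳ x)) (∣n⇒∣m*n 0ℤ ℤD.∣-refl))

  ≡-mod-sym : ∀ {x y} → x ≡ y mod m → y ≡ x mod m
  ≡-mod-sym {x} {y} (modulo x≡y) = modulo (subst (+ m ∣ℤ_) (negate x y) (∣m⇒∣-m x≡y))
    where
    negate : ∀ x y → - (x - y) ≡ y - x
    negate = solve-∀

  ≡-mod-trans : ∀ {x y z} → x ≡ y mod m → y ≡ z mod m → x ≡ z mod m
  ≡-mod-trans {x} {y} {z} (modulo x≡y) (modulo y≡z) =
    modulo (subst (+ m ∣ℤ_) (telescope x y z) (∣m∣n⇒∣m+n x≡y y≡z))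
    where
    telescope : ∀ x y z → (x - y) + (y - z) ≡ x - z
    telescope = solve-∀

  +-congˡ-mod : ∀ z {x y} → x ≡ y mod m → z + x ≡ z + y mod m
  +-congˡ-mod z {x} {y} (modulo x≡y) = modulo (subst (+ m ∣ℤ_) (cancel z x y) x≡y)
    where
    cancel : ∀ z x y → x - y ≡ (z + x) - (z + y)
    cancel = solve-∀

  +-congʳ-mod : ∀ z {x y} → x ≡ y mod m → x + z ≡ y + z mod m
  +-congʳ-mod z {x} {y} (modulo x≡y) = modulo (subst (+ m ∣ℤ_) (cancel z x y) x≡y)
    where
    cancel : ∀ z x y → x - y ≡ (x + z) - (y + z)
    cancel = solve-∀

  *-congˡ-mod : ∀ z {x y} → x ≡ y mod m → z * x ≡ z * y mod m
  *-congˡ-mod z {x} {y} (modulo x≡y) = modulo (subst (+ m ∣ℤ_) (distrib z x y) (∣n⇒∣m*n z x≡y))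
    where
    distrib : ∀ z x y → z * (x - y) ≡ z * x - z * y
    distrib = solve-∀

  *-congʳ-mod : ∀ z {x y} → x ≡ y mod m → x * z ≡ y * z mod m
  *-congʳ-mod z {x} {y} (modulo x≡y) = modulo (subst (+ m ∣ℤ_) (distrib z x y) (∣n⇒∣m*n z x≡y))
    where
    distrib : ∀ z x y → z * (x - y) ≡ x * z - y * z
    distrib = solve-∀

  ≡-mod-isEquivalence : IsEquivalence (λ x y → x ≡ y mod m)
  ≡-mod-isEquivalence = record { refl = ≡⇒≡-mod refl ; sym = ≡-mod-sym ; trans = ≡-mod-trans }

≡-mod-setoid : ℕ → Setoid _ _
≡-mod-setoid m = record { isEquivalence = ≡-mod-isEquivalence {m} }

module ≡-mod-Reasoning (m : ℕ) = SetoidReasoning (≡-mod-setoid m)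

_≡?_mod_ : ∀ x y m → Dec (x ≡ y mod m)
x ≡? y mod m = map′ modulo divides-difference (+ m ℤD.∣? (x - y))

x+k*m≡x-mod : ∀ {m} x k → x + k * + m ≡ x mod m
x+k*m≡x-mod {m} x k = modulo (subst (+ m ∣ℤ_) (cancel x (k * + m)) (∣n⇒∣m*n k ℤD.∣-refl))
  where
  cancel : ∀ x y → y ≡ (x + y) - x
  cancel = solve-∀

≡-mod-weaken : ∀ {d m x y} → d ∣ m → x ≡ y mod m → x ≡ y mod d
≡-mod-weaken d∣m (modulo m∣x-y) = modulo (ℤD.∣-trans (∣ᵤ⇒∣ d∣m) m∣x-y)

inverse-mod⁺ : ∀ {n m} → Coprime n m → Σ ℤ λ t → t * + n ≡ 1ℤ mod m
inverse-mod⁺ {n} {m} n⊥m with Coprimality.coprime-Bézout n⊥m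
... | Bézout.+- x y 1+ym≡xn = + x , (begin
  + x * + n              ≡⟨ ℤP.pos-* x n ⟨
  + (x ℕ.* n)            ≡⟨ cong +_ 1+ym≡xn ⟨
  + (1 ℕ.+ y ℕ.* m)      ≡⟨ ℤP.pos-+ 1 (y ℕ.* m) ⟩
  1ℤ + + (y ℕ.* m)       ≡⟨ cong (_+_ 1ℤ) (ℤP.pos-* y m) ⟩
  1ℤ + + y * + m         ≈⟨ x+k*m≡x-mod 1ℤ (+ y) ⟩
  1ℤ                     ∎)
  where open ≡-mod-Reasoning m
... | Bézout.-+ x y 1+xn≡ym = - + x , (begin
  - + x * + n            ≡⟨ negate (+ x) (+ n) ⟩
  1ℤ - (1ℤ + + x * + n)  ≡⟨ cong (λ z → 1ℤ - z) (trans (ℤP.pos-+ 1 (x ℕ.* n)) (cong (_+_ 1ℤ) (ℤP.pos-* x n))) ⟨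
  1ℤ - + (1 ℕ.+ x ℕ.* n) ≡⟨ cong (λ z → 1ℤ - + z) 1+xn≡ym ⟩
  1ℤ - + (y ℕ.* m)       ≡⟨ cong (λ z → 1ℤ - z) (ℤP.pos-* y m) ⟩
  1ℤ - + y * + m         ≡⟨ cong (_+_ 1ℤ) (ℤP.neg-distribˡ-* (+ y) (+ m)) ⟩
  1ℤ + - + y * + m       ≈⟨ x+k*m≡x-mod 1ℤ (- + y) ⟩
  1ℤ                     ∎)
  where
  open ≡-mod-Reasoning m
  negate : ∀ a b → - a * b ≡ 1ℤ - (1ℤ + a * b)
  negate = solve-∀

inverse-mod : ∀ s {m} → Coprime ∣ s ∣ m → Σ ℤ λ t → t * s ≡ 1ℤ mod m
inverse-mod s {m} s⊥m with inverse-mod⁺ s⊥m | ℤP.+∣i∣≡i⊎+∣i∣≡-i s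
... | t , t-inverse | inj₁ ∣s∣≡s = t , subst (λ z → t * z ≡ 1ℤ mod m) ∣s∣≡s t-inverse
... | t , t-inverse | inj₂ ∣s∣≡-s = - t , subst (λ z → z ≡ 1ℤ mod m) flip-sign t-inverse
  where
  flip-sign : t * + ∣ s ∣ ≡ - t * s
  flip-sign = trans (cong (t *_) ∣s∣≡-s) (trans (sym (ℤP.neg-distribʳ-* t s)) (ℤP.neg-distribˡ-* t s))

level : ∀ {m} → Fin m → ℤ
level σ = + toℕ σ

module Residue (m : ℕ) .{{m≢0 : NonZero m}} where
  open ≡-mod-Reasoning m

  residue : ℤ → Fin m
  residue z = fromℕ< (n%ℕd<d z m)

  small-≡-mod⇒≡ : ∀ {r s} → s ℕ.≤ r → r < m → + r ≡ + s mod m → r ≡ s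
  small-≡-mod⇒≡ {r} {s} s≤r r<m (modulo m∣r-s) = ℕP.≤-antisym (ℕP.m∸n≡0⇒m≤n r∸s≡0) s≤r
    where
    m∣r∸s : m ∣ r ℕ.∸ s
    m∣r∸s = subst (λ d → m ∣ ∣ d ∣) (trans (ℤP.m-n≡m⊖n r s) (ℤP.⊖-≥ s≤r)) (∣⇒∣ᵤ m∣r-s)
    r∸s≡0 : r ℕ.∸ s ≡ 0
    r∸s≡0 = trans (sym (ℕDM.m<n⇒m%n≡m (ℕP.≤-<-trans (ℕP.m∸n≤m r s) r<m))) (n∣m⇒m%n≡0 _ m m∣r∸s)

  level-≡-mod⇒≡ : ∀ {σ τ} → level σ ≡ level τ mod m → σ ≡ τ
  level-≡-mod⇒≡ {σ} {τ} σ≡τ with ℕP.≤-total (toℕ τ) (toℕ σ)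
  ... | inj₁ τ≤σ = toℕ-injective (small-≡-mod⇒≡ τ≤σ (toℕ<n σ) σ≡τ)
  ... | inj₂ σ≤τ = toℕ-injective (sym (small-≡-mod⇒≡ σ≤τ (toℕ<n τ) (≡-mod-sym σ≡τ)))

  level-residue : ∀ z → level (residue z) ≡ z mod m
  level-residue z = begin
    level (residue z)              ≡⟨ cong +_ (toℕ-fromℕ< (n%ℕd<d z m)) ⟩
    + (z %ℕ m)                     ≈⟨ x+k*m≡x-mod (+ (z %ℕ m)) (z /ℕ m) ⟨
    + (z %ℕ m) + (z /ℕ m) * + m    ≡⟨ a≡a%ℕn+[a/ℕn]*n z m ⟨
    z                              ∎

  residue-≡-level : ∀ {z σ} → z ≡ level σ mod m → residue z ≡ σ
  residue-≡-level {z} z≡σ = level-≡-mod⇒≡ (≡-mod-trans (level-residue z) z≡σ)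

  residue-cong : ∀ {x y} → x ≡ y mod m → residue x ≡ residue y
  residue-cong {x} {y} x≡y = residue-≡-level (begin
    x                  ≈⟨ x≡y ⟩
    y                  ≈⟨ level-residue y ⟨
    level (residue y)  ∎)

  level-addMod : ∀ σ b → level (addMod m σ b) ≡ level σ + + b mod m
  level-addMod σ b = begin
    level (addMod m σ b)       ≈⟨ level-residue (+ (toℕ σ ℕ.+ b)) ⟩
    + (toℕ σ ℕ.+ b)            ≡⟨ ℤP.pos-+ (toℕ σ) b ⟩
    level σ + + b              ∎

-- Walks in X̃

infixr 5 _++ᵖ_

_++ᵖ_ : ∀ {X u v x} → Path X u v → Path X v x → Path X u x
[] ++ᵖ ρ = ρ
(d ∷ π) ++ᵖ ρ = d ∷ (π ++ᵖ ρ)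

weight-++ᵖ : ∀ {X u v x} (π : Path X u v) (ρ : Path X v x) → weight (π ++ᵖ ρ) ≡ weight π + weight ρ
weight-++ᵖ [] ρ = sym (ℤP.+-identityˡ (weight ρ))
weight-++ᵖ {X} (d ∷ π) ρ = begin
  w X d + weight (π ++ᵖ ρ)       ≡⟨ cong (_+_ (w X d)) (weight-++ᵖ π ρ) ⟩
  w X d + (weight π + weight ρ)  ≡⟨ ℤP.+-assoc (w X d) (weight π) (weight ρ) ⟨
  w X d + weight π + weight ρ    ∎
  where open ≡-Reasoning

starts-++ᵖ : ∀ {X u v x} (π : Path X u v) (ρ : Path X v x) → starts (π ++ᵖ ρ) ≡ starts π ++ starts ρ
starts-++ᵖ [] ρ = refl
starts-++ᵖ {X} (d ∷ π) ρ = cong (dsrc X d ∷_) (starts-++ᵖ π ρ)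

infixr 8 _^ᵖ_

_^ᵖ_ : ∀ {X v} → Path X v v → ℕ → Path X v v
c ^ᵖ zero = []
c ^ᵖ suc k = c ++ᵖ c ^ᵖ k

weight-^ᵖ : ∀ {X v} (c : Path X v v) k → weight (c ^ᵖ k) ≡ + k * weight c
weight-^ᵖ c zero = sym (ℤP.*-zeroˡ (weight c))
weight-^ᵖ c (suc k) = begin
  weight (c ++ᵖ c ^ᵖ k)        ≡⟨ weight-++ᵖ c (c ^ᵖ k) ⟩
  weight c + weight (c ^ᵖ k)   ≡⟨ cong (_+_ (weight c)) (weight-^ᵖ c k) ⟩
  weight c + + k * weight c    ≡⟨ ℤP.suc-* (+ k) (weight c) ⟨
  + suc k * weight c           ∎
  where open ≡-Reasoning

Joined⇒Path : ∀ {X u v} → Joined (toDiGraph X) u v → Path X u v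
Joined⇒Path here = []
Joined⇒Path (fwd e j) = inj₁ e ∷ Joined⇒Path j
Joined⇒Path (bwd e j) = inj₂ e ∷ Joined⇒Path j

SimpleCycleWith : (X : FinGraph) → (ℤ → Set) → Set
SimpleCycleWith X P = Σ (Fin (nV X)) λ v → Σ (Path X v v) λ c →
  (0 < pathLength c) × Unique (starts c) × P (weight c)

map-SimpleCycleWith : ∀ {X} {P Q : ℤ → Set} → (∀ {z} → P z → Q z) →
                      SimpleCycleWith X P → SimpleCycleWith X Q
map-SimpleCycleWith P⇒Q (v , c , nonempty , simple , Pc) = v , c , nonempty , simple , P⇒Q Pc

AllPairs-++⁻ : ∀ {a r} {A : Set a} {R : Rel A r} xs {ys} → AllPairs R (xs ++ ys) → AllPairs R xs × AllPairs R ys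
AllPairs-++⁻ [] rs = [] , rs
AllPairs-++⁻ (x ∷ xs) (r ∷ rs) with AllPairs-++⁻ xs rs
... | rxs , rys = ++⁻ˡ xs r ∷ rxs , rys

splitAtFirst : ∀ {X u v} x (π : Path X u v) → x ∈ starts π →
  Σ (Path X u x) λ ρ₁ → Σ (Path X x v) λ ρ₂ → x ∉ starts ρ₁ × π ≡ ρ₁ ++ᵖ ρ₂
splitAtFirst {X} x (d ∷ π) x∈ with x Fin.≟ dsrc X d
... | yes refl = [] , d ∷ π , (λ ()) , refl
splitAtFirst x (d ∷ π) (here x≡) | no x≢ = ⊥-elim (x≢ x≡)
splitAtFirst x (d ∷ π) (there x∈) | no x≢ with splitAtFirst x π x∈
... | ρ₁ , ρ₂ , x∉ , refl = d ∷ ρ₁ , ρ₂ , (λ { (here x≡) → x≢ x≡ ; (there x∈ρ₁) → x∉ x∈ρ₁ }) , refl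

module _ {X : FinGraph} (m : ℕ) where
  open import Data.List.Membership.DecPropositional (Fin._≟_ {nV X}) using (_∈?_)

  -- Shortens π from its end: if the first vertex of π recurs in the simple remainder, the
  -- loop cut off there is a simple cycle, which is either the one sought or can be dropped.
  simplify : ∀ {u v} (π : Path X u v) →
    SimpleCycleWith X (λ z → ¬ z ≡ 0ℤ mod m) ⊎
    Σ (Path X u v) λ π′ → Unique (starts π′) × weight π ≡ weight π′ mod m
  simplify [] = inj₂ ([] , [] , ≡⇒≡-mod refl)
  simplify (d ∷ π) with simplify π
  ... | inj₁ cycle = inj₁ cycle
  ... | inj₂ (π′ , simple , π≡π′) with dsrc X d ∈? starts π′
  ...   | no d∉π′ = inj₂ (d ∷ π′ , ¬Any⇒All¬ _ d∉π′ ∷ simple , +-congˡ-mod (w X d) π≡π′)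
  ...   | yes d∈π′ with splitAtFirst (dsrc X d) π′ d∈π′
  ...     | ρ₁ , ρ₂ , d∉ρ₁ , refl with AllPairs-++⁻ (starts ρ₁) (subst Unique (starts-++ᵖ ρ₁ ρ₂) simple)
  ...       | simple₁ , simple₂ with w X d + weight ρ₁ ≡? 0ℤ mod m
  ...         | no c≢0 = inj₁ (dsrc X d , d ∷ ρ₁ , s≤s z≤n , ¬Any⇒All¬ _ d∉ρ₁ ∷ simple₁ , c≢0)
  ...         | yes c≡0 = inj₂ (ρ₂ , simple₂ , shortcut)
    where
    open ≡-mod-Reasoning m
    shortcut : w X d + weight π ≡ weight ρ₂ mod m
    shortcut = begin
      w X d + weight π                    ≈⟨ +-congˡ-mod (w X d) π≡π′ ⟩
      w X d + weight (ρ₁ ++ᵖ ρ₂)          ≡⟨ cong (_+_ (w X d)) (weight-++ᵖ ρ₁ ρ₂) ⟩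
      w X d + (weight ρ₁ + weight ρ₂)     ≡⟨ ℤP.+-assoc (w X d) (weight ρ₁) (weight ρ₂) ⟨
      (w X d + weight ρ₁) + weight ρ₂     ≈⟨ +-congʳ-mod (weight ρ₂) c≡0 ⟩
      0ℤ + weight ρ₂                      ≡⟨ ℤP.+-identityˡ (weight ρ₂) ⟩
      weight ρ₂                           ∎

  simpleCycle : ∀ {v} (π : Path X v v) → ¬ weight π ≡ 0ℤ mod m →
                SimpleCycleWith X (λ z → ¬ z ≡ 0ℤ mod m)
  simpleCycle π π≢0 with simplify π
  ... | inj₁ cycle = cycle
  ... | inj₂ ([] , _ , π≡0) = ⊥-elim (π≢0 π≡0)
  ... | inj₂ (d ∷ ρ , simple , π≡c) = _ , d ∷ ρ , s≤s z≤n , simple , λ c≡0 → π≢0 (≡-mod-trans π≡c c≡0)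

-- Derived graphs of a constant voltage assignment

-- The voltage β is given together with its constant value A because α_{/n} is constant
-- only pointwise, not definitionally.
module ConstantVoltage (X : FinGraph) (m : ℕ) .{{m≢0 : NonZero m}}
                       (β : Fin (nE X) → ℕ) (A : ℕ) (β≡A : ∀ e → β e ≡ A) where
  open Residue m
  open ≡-mod-Reasoning m

  private
    stay : ∀ l a → l + a * 0ℤ ≡ l
    stay = solve-∀
    forward-shift : ∀ l a x → l + a + a * x ≡ l + a * (1ℤ + x)
    forward-shift = solve-∀
    backward-shift : ∀ l a x → l - a + a * x ≡ l + a * (- 1ℤ + x)
    backward-shift = solve-∀
    cancel : ∀ l a → l - a + a ≡ l
    cancel = solve-∀
    unshift : ∀ l a x → l + a * x ≡ l + a + a * (- 1ℤ + x)
    unshift = solve-∀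

  G : DiGraph
  G = derived X m β

  level-step : ∀ e σ → level (addMod m σ (β e)) ≡ level σ + + A mod m
  level-step e σ = begin
    level (addMod m σ (β e))   ≈⟨ level-addMod σ (β e) ⟩
    level σ + + β e            ≡⟨ cong (λ b → level σ + + b) (β≡A e) ⟩
    level σ + + A              ∎

  lift : ∀ {u u′} (π : Path X u u′) (σ : Fin m) → Joined G (u , σ) (u′ , residue (level σ + + A * weight π))
  lift [] σ =
    subst (λ τ → Joined G (_ , σ) (_ , τ)) (sym (residue-≡-level (≡⇒≡-mod (stay (level σ) (+ A))))) here
  lift (inj₁ e ∷ ρ) σ =
    fwd (e , σ) (subst (λ τ → Joined G _ (_ , τ)) (residue-cong forward) (lift ρ (addMod m σ (β e))))
    where
    l = level σ
    a = + A
    x = weight ρ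
    forward : level (addMod m σ (β e)) + a * x ≡ l + a * (1ℤ + x) mod m
    forward = begin
      level (addMod m σ (β e)) + a * x    ≈⟨ +-congʳ-mod (a * x) (level-step e σ) ⟩
      l + a + a * x                       ≡⟨ forward-shift l a x ⟩
      l + a * (1ℤ + x)                    ∎
  lift (inj₂ e ∷ ρ) σ =
    subst₂ (Joined G) (cong (ftgt X e ,_) arrive) (cong (_ ,_) (residue-cong backward)) (bwd (e , σ₀) (lift ρ σ₀))
    where
    l = level σ
    a = + A
    x = weight ρ
    σ₀ = residue (l - a)
    arrive : addMod m σ₀ (β e) ≡ σ
    arrive = level-≡-mod⇒≡ (begin
      level (addMod m σ₀ (β e))   ≈⟨ level-step e σ₀ ⟩
      level σ₀ + a                ≈⟨ +-congʳ-mod a (level-residue (l - a)) ⟩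
      l - a + a                   ≡⟨ cancel l a ⟩
      l                           ∎)
    backward : level σ₀ + a * x ≡ l + a * (- 1ℤ + x) mod m
    backward = begin
      level σ₀ + a * x            ≈⟨ +-congʳ-mod (a * x) (level-residue (l - a)) ⟩
      l - a + a * x               ≡⟨ backward-shift l a x ⟩
      l + a * (- 1ℤ + x)          ∎

  project : ∀ {x y} → Joined G x y →
    Σ (Path X (proj₁ x) (proj₁ y)) λ π → level (proj₂ y) ≡ level (proj₂ x) + + A * weight π mod m
  project {x} here = [] , ≡⇒≡-mod (sym (stay (level (proj₂ x)) (+ A)))
  project {y = y} (fwd (e , σ) j) with project j
  ... | π , y≡ = inj₁ e ∷ π , (begin
    level (proj₂ y)                              ≈⟨ y≡ ⟩
    level (addMod m σ (β e)) + + A * weight π    ≈⟨ +-congʳ-mod (+ A * weight π) (level-step e σ) ⟩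
    level σ + + A + + A * weight π               ≡⟨ forward-shift (level σ) (+ A) (weight π) ⟩
    level σ + + A * (1ℤ + weight π)              ∎)
  project {y = y} (bwd (e , σ) j) with project j
  ... | π , y≡ = inj₂ e ∷ π , (begin
    level (proj₂ y)                                      ≈⟨ y≡ ⟩
    level σ + + A * weight π                             ≡⟨ unshift (level σ) (+ A) (weight π) ⟩
    level σ + + A + + A * (- 1ℤ + weight π)              ≈⟨ +-congʳ-mod (+ A * (- 1ℤ + weight π)) (level-step e σ) ⟨
    level (addMod m σ (β e)) + + A * (- 1ℤ + weight π)   ∎)

  closedWalk : Connected G → Σ (Fin (nV X)) λ v → Σ (Path X v v) λ π → + A * weight π ≡ 1ℤ mod m
  closedWalk ((v , _) , joined) with project (joined (v , residue 0ℤ) (v , residue 1ℤ))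
  ... | π , 1≡ = v , π , (begin
    + A * weight π                          ≡⟨ ℤP.+-identityˡ (+ A * weight π) ⟨
    0ℤ + + A * weight π                     ≈⟨ +-congʳ-mod (+ A * weight π) (level-residue 0ℤ) ⟨
    level (residue 0ℤ) + + A * weight π     ≈⟨ 1≡ ⟨
    level (residue 1ℤ)                      ≈⟨ level-residue 1ℤ ⟩
    1ℤ                                      ∎)

  connected : Connected (toDiGraph X) → ∀ {v} (c : Path X v v) (t : ℤ) →
              t * (+ A * weight c) ≡ 1ℤ mod m → Connected G
  connected (x₀ , joinedX) {v} c t t-inverse = (x₀ , residue 0ℤ) , λ (u , σ) (u′ , σ′) → reach u σ u′ σ′
    where
    regroup : ∀ l a p k c q → l + a * (p + (k * c + q)) ≡ l + a * (p + q) + k * (a * c)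
    regroup = solve-∀
    reassociate : ∀ t d s → t * d * s ≡ d * (t * s)
    reassociate = solve-∀
    complete : ∀ b l → b + (l - b) * 1ℤ ≡ l
    complete = solve-∀

    reach : ∀ u σ u′ σ′ → Joined G (u , σ) (u′ , σ′)
    reach u σ u′ σ′ = subst (λ τ → Joined G (u , σ) (u′ , τ)) (residue-≡-level arrives) (lift walk σ)
      where
      π₁ = Joined⇒Path (joinedX u v)
      π₂ = Joined⇒Path (joinedX v u′)
      s = + A * weight c
      b = level σ + + A * (weight π₁ + weight π₂)
      d = level σ′ - b
      -- going round c k ≡ t·d times raises the level by d·(t·s) ≡ d (mod m)
      k = toℕ (residue (t * d))
      walk = π₁ ++ᵖ c ^ᵖ k ++ᵖ π₂
      weight-walk : weight walk ≡ weight π₁ + (+ k * weight c + weight π₂)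
      weight-walk = trans (weight-++ᵖ π₁ (c ^ᵖ k ++ᵖ π₂))
        (cong (_+_ (weight π₁)) (trans (weight-++ᵖ (c ^ᵖ k) π₂) (cong (_+ weight π₂) (weight-^ᵖ c k))))
      arrives : level σ + + A * weight walk ≡ level σ′ mod m
      arrives = begin
        level σ + + A * weight walk                                ≡⟨ cong (λ z → level σ + + A * z) weight-walk ⟩
        level σ + + A * (weight π₁ + (+ k * weight c + weight π₂))
          ≡⟨ regroup (level σ) (+ A) (weight π₁) (+ k) (weight c) (weight π₂) ⟩
        b + + k * s                                                ≈⟨ +-congˡ-mod b (*-congʳ-mod s (level-residue (t * d))) ⟩
        b + t * d * s                                              ≡⟨ cong (_+_ b) (reassociate t d s) ⟩
        b + d * (t * s)                                            ≈⟨ +-congˡ-mod b (*-congˡ-mod d t-inverse) ⟩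
        b + d * 1ℤ                                                 ≡⟨ complete b (level σ′) ⟩
        level σ′                                                   ∎

-- p-adic digits and coprimality

coprime-^ : ∀ {x y} n → Coprime x y → Coprime x (y ^ n)
coprime-^ zero _ = Coprimality.sym (Coprimality.1-coprimeTo _)
coprime-^ {x} {y} (suc n) x⊥y {d} (d∣x , d∣y^1+n) = coprime-^ n x⊥y (d∣x , Coprimality.coprime-divisor d⊥y d∣y^1+n)
  where
  d⊥y : Coprime d y
  d⊥y (e∣d , e∣y) = x⊥y (∣-trans e∣d d∣x , e∣y)

digitSum-cong : ∀ {p a b} → (∀ i → a i ≡ b i) → ∀ n → digitSum p a n ≡ digitSum p b n
digitSum-cong a≗b zero = refl
digitSum-cong {p} a≗b (suc n) = cong₂ (λ s d → s ℕ.+ toℕ d ℕ.* p ^ n) (digitSum-cong a≗b n) (a≗b n)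

digitSum[1+n]%p≡digit₀ : ∀ {p} .{{_ : NonZero p}} a n → digitSum p a (suc n) % p ≡ toℕ (a 0)
digitSum[1+n]%p≡digit₀ {p} a zero = trans (cong (_% p) (ℕP.*-identityʳ (toℕ (a 0)))) (ℕDM.m<n⇒m%n≡m (toℕ<n (a 0)))
digitSum[1+n]%p≡digit₀ {p} a (suc n) = begin
  (s ℕ.+ x ℕ.* (p ℕ.* p ^ n)) % p   ≡⟨ cong (λ k → (s ℕ.+ k) % p) (regroup x p (p ^ n)) ⟩
  (s ℕ.+ x ℕ.* p ^ n ℕ.* p) % p     ≡⟨ ℕDM.[m+kn]%n≡m%n s (x ℕ.* p ^ n) p ⟩
  s % p                             ≡⟨ digitSum[1+n]%p≡digit₀ a n ⟩
  toℕ (a 0)                         ∎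
  where
  open ≡-Reasoning
  regroup : ∀ x p q → x ℕ.* (p ℕ.* q) ≡ x ℕ.* q ℕ.* p
  regroup = ℕSolver.solve-∀
  s = digitSum p a (suc n)
  x = toℕ (a (suc n))

module _ {p} (pr : Prime p) where
  private instance
    p≢0 : NonZero p
    p≢0 = prime⇒nonZero pr

  ∤⇒coprime : ∀ {x} → ¬ p ∣ x → Coprime x p
  ∤⇒coprime p∤x (d∣x , d∣p) with prime⇒irreducible pr d∣p
  ... | inj₁ d≡1 = d≡1
  ... | inj₂ refl = ⊥-elim (p∤x d∣x)

  coprime⇒∤ : ∀ {x} → Coprime x p → ¬ p ∣ x
  coprime⇒∤ x⊥p p∣x = ¬prime[1] (subst Prime (x⊥p (p∣x , ∣-refl)) pr)

  ≢0-mod⇒coprime : ∀ {z} → ¬ z ≡ 0ℤ mod p → Coprime ∣ z ∣ p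
  ≢0-mod⇒coprime {z} z≢0 = ∤⇒coprime λ p∣z →
    z≢0 (modulo (subst (+ p ∣ℤ_) (sym (ℤP.+-identityʳ z)) (∣ᵤ⇒∣ p∣z)))

  invertible⇒≢0-mod : ∀ a {x} → a * x ≡ 1ℤ mod p → ¬ x ≡ 0ℤ mod p
  invertible⇒≢0-mod a {x} ax≡1 x≡0 = ¬prime[1] (subst Prime (∣1⇒≡1 (∣⇒∣ᵤ (divides-difference 1≡0))) pr)
    where
    open ≡-mod-Reasoning p
    1≡0 : 1ℤ ≡ 0ℤ mod p
    1≡0 = begin
      1ℤ      ≈⟨ ax≡1 ⟨
      a * x   ≈⟨ *-congˡ-mod a x≡0 ⟩
      a * 0ℤ  ≡⟨ ℤP.*-zeroʳ a ⟩
      0ℤ      ∎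

  unit⇒∤digitSum : ∀ {a} → IsUnit p a → ∀ n → ¬ p ∣ digitSum p a (suc n)
  unit⇒∤digitSum {a} a-unit n p∣s = a-unit (trans (sym (digitSum[1+n]%p≡digit₀ a n)) (n∣m⇒m%n≡0 _ p p∣s))

  unit*coprime⇒coprime-^ : ∀ {a z} → IsUnit p a → Coprime ∣ z ∣ p →
                           ∀ n → Coprime ∣ + reduce p a n * z ∣ (p ^ n)
  unit*coprime⇒coprime-^ a-unit z⊥p zero = Coprimality.sym (Coprimality.1-coprimeTo _)
  unit*coprime⇒coprime-^ {a} {z} a-unit z⊥p (suc n) =
    subst (λ k → Coprime k (p ^ suc n)) (sym (ℤP.abs-* (+ reduce p a (suc n)) z))
      (coprime-^ (suc n) (∤⇒coprime p∤Az))
    where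
    p∤Az : ¬ p ∣ reduce p a (suc n) ℕ.* ∣ z ∣
    p∤Az p∣Az = [ unit⇒∤digitSum a-unit n , coprime⇒∤ z⊥p ]′ (euclidsLemma _ _ pr p∣Az)

proposition3p5 : (p : ℕ) → (pr : Prime p) → (X : FinGraph) → Connected (toDiGraph X)
    → (α : Fin (nE X) → ℤp p) → (a : ℤp p) → (∀ e i → α e i ≡ a i) → IsUnit p a
    → ((n : ℕ) → Connected (derivedPn X p pr α n))
      ⇔ (Σ (Fin (nV X)) λ v → Σ (Path X v v) λ c →
           (0 < pathLength c) × Unique (starts c) × Coprime ∣ weight c ∣ p)
-- derivedPn only unfolds once the primality proof is a constructor, hence the match on prime.
proposition3p5 p pr@(prime _) X X-connected α a α≡a a-unit = mk⇔ cycleOfConnected connectedOfCycle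
  where
  module Level (n : ℕ) = ConstantVoltage X (p ^ n) {{ℕP.m^n≢0 p n {{prime⇒nonZero pr}}}}
    (λ e → reduce p (α e) n) (reduce p a n) (λ e → digitSum-cong (α≡a e) n)

  cycleOfConnected : (∀ n → Connected (derivedPn X p pr α n)) → SimpleCycleWith X (λ z → Coprime ∣ z ∣ p)
  cycleOfConnected connected =
    let _ , π , π-invertible = Level.closedWalk 1 (connected 1)
    in map-SimpleCycleWith (λ {z} → ≢0-mod⇒coprime pr {z})
         (simpleCycle p π (invertible⇒≢0-mod pr (+ reduce p a 1) (≡-mod-weaken (m∣m*n 1) π-invertible)))

  connectedOfCycle : SimpleCycleWith X (λ z → Coprime ∣ z ∣ p) → ∀ n → Connected (derivedPn X p pr α n)
  connectedOfCycle (_ , c , _ , _ , c⊥p) n =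
    let t , t-inverse = inverse-mod (+ reduce p a n * weight c) (unit*coprime⇒coprime-^ pr a-unit c⊥p n)
    in Level.connected n X-connected c t t-inverse
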